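{- Let $\mathcal{H}=(V,\mathcal{E})$ be a multi-hypergraph of rank at most $k\ge 2$ on $n$ vertices, and let $E\subseteq\binom{V}{2}$ be a set of pairs $\{u,v\}$ of vertices such that for each such pair there is a (chosen) edge $e_{uv}$ of $\mathcal{H}$ containing $u$ and $v$ (possibly $e_{uv}=e_{xy}$ for different pairs). Then the graph $(V,E)$ contains a subgraph $H$ with $\mathrm{ad}(H)\ge \frac{2|E|}{n\mathrm{e} k}$ such that for every edge $uv$ of $H$, the edge $e_{uv}$ contains no vertex of $V(H)\setminus\{u,v\}$.
   Context: A multi-hypergraph is a pair $(V,\mathcal{E})$ where $\mathcal{E}$ is a multiset of subsets of the finite set $V$; its rank is the maximum cardinality of an edge. For a graph $H$, $\mathrm{ad}(H)=2|E(H)|/|V(H)|$ is its average degree. $\mathrm{e}$ is the base of the natural logarithm. -}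

module Defs where

open import Data.Nat using (ℕ; zero; suc; _+_; _*_; _≤_)
open import Data.Nat.Combinatorics using ()
open import Data.Nat.Base using (_!)
open import Data.Product using (∃-syntax; _×_; proj₁; proj₂)
open import Data.Fin using (Fin)
open import Data.Vec using (Vec; lookup)

-- eNum N = Σ_{j ≤ N} N!/j!, so that eNum N / N! = Σ_{j ≤ N} 1/j!
-- is the N-th partial sum of the series for e.
eNum : ℕ → ℕ
eNum zero = 1
eNum (suc N) = suc N * eNum N + 1

-- LeTimesE p q  means the real inequality  p ≤ q · e.
-- Since e = sup_N eNum N / N! and e is irrational, for naturals p q
-- this holds iff some partial sum already witnesses it.
LeTimesE : ℕ → ℕ → Set
LeTimesE p q = ∃[ N ] (p * (N !) ≤ q * eNum N)

fstP : ∀ {n p} → Vec (Fin n × Fin n) p → Fin p → Fin n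
fstP E i = proj₁ (lookup E i)

sndP : ∀ {n p} → Vec (Fin n × Fin n) p → Fin p → Fin n
sndP E i = proj₂ (lookup E i)

-- Choose W at random, each vertex independently with probability 1/k, and keep the pairs uv
-- of E whose hyperedge e_uv meets W exactly in {u, v}. A pair survives with probability at
-- least k⁻² (1 − 1/k)^(k−2), while E|W| = n/k; so by linearity of expectation some W satisfies
-- |E| |W| ≤ k n (1 + 1/(k−1))^(k−2) · #survivors, and (1 + 1/(k−1))^(k−2) < e. As both sides
-- vanish at W = ∅, such a W can be taken nonempty. To stay in ℕ the probabilities are scaled
-- by k^n: a subset W of the n vertices gets weight (k − 1)^(n − |W|).
module Submission where

open import Algebra.Bundles using (Semiring)
import Algebra.Definitions.RawMonoid as RawMonoid
import Algebra.Properties.Semiring.Binomial as Binomial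
open import Data.Bool.Base using (Bool; true; false; _∧_; not; T)
open import Data.Bool.Properties using (T-∧; T-≡)
open import Data.Fin using (Fin; zero; suc; toℕ) renaming (_<_ to _<ᶠ_)
open import Data.Fin.Properties using (toℕ≤pred[n])
open import Data.Fin.Subset using (Subset; Side; inside; outside; ∣_∣; _∈_; _∪_; _⊆_; ⊥; ⁅_⁆)
open import Data.Fin.Subset.Properties using (∉⊥; x∈⁅x⁆; x∈⁅y⁆⇒x≡y; x∈p∪q⁺; x∈p∪q⁻; ∣⁅x⁆∣≡1; p⊆q⇒∣p∣≤∣q∣)
open import Data.Nat using (ℕ; zero; suc; _+_; _*_; _^_; _!; _∸_; _≤_; _<_; _≤′_; ≤′-refl; ≤′-step; z≤n; s≤s; z<s; NonZero)
open import Data.Nat.Combinatorics using (_C_; nC1≡n; k>n⇒nCk≡0; nCk+nC[k+1]≡[n+1]C[k+1])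
open import Data.Nat.Properties
open import Data.Nat.Tactic.RingSolver using (solve-∀)
open import Data.Product using (Σ; ∃-syntax; _×_; _,_; proj₁; proj₂; map)
open import Data.Sum using (_⊎_; inj₁; inj₂)
open import Data.Vec using (Vec; []; _∷_; lookup; tabulate; here; there)
open import Data.Vec.Functional using (Vector)
open import Data.Vec.Properties using ([]=⇒lookup; lookup∘tabulate)
open import Defs
open import Function using (_∘_; id)
open import Function.Bundles using (Equivalence)
open import Relation.Binary.PropositionalEquality using (_≡_; refl; sym; trans; cong; cong₂; subst; subst₂; module ≡-Reasoning)
open import Relation.Nullary using (yes; no; contradiction)

open import Algebra.Properties.CommutativeMonoid.Sum +-0-commutativeMonoid using (sum; sum-cong-≗; sum-syntax; sum⁺-syntax)
open import Algebra.Properties.CommutativeSemigroup *-commutativeSemigroup using (x∙yz≈y∙xz; x∙yz≈yx∙z)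
open import Algebra.Properties.Semiring.Sum +-*-semiring using (*-distribˡ-sum; *-distribʳ-sum)

𝟙 : Bool → ℕ
𝟙 true  = 1
𝟙 false = 0

sum-mono-≤ : ∀ {n} {f g : Vector ℕ n} → (∀ i → f i ≤ g i) → sum f ≤ sum g
sum-mono-≤ {zero}  f≤g = z≤n
sum-mono-≤ {suc n} f≤g = +-mono-≤ (f≤g zero) (sum-mono-≤ (f≤g ∘ suc))

sum-const : ∀ n c → ∑[ i < n ] c ≡ n * c
sum-const zero    c = refl
sum-const (suc n) c = cong (c +_) (sum-const n c)

∣tabulate∣≡∑𝟙 : ∀ {n} (f : Fin n → Bool) → ∣ tabulate f ∣ ≡ ∑[ i < n ] 𝟙 (f i)
∣tabulate∣≡∑𝟙 {zero}  f = refl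
∣tabulate∣≡∑𝟙 {suc n} f with f zero
... | true  = cong suc (∣tabulate∣≡∑𝟙 (f ∘ suc))
... | false = ∣tabulate∣≡∑𝟙 (f ∘ suc)

∈-tabulate⇒T : ∀ {n} {f : Fin n → Bool} {i} → i ∈ tabulate f → T (f i)
∈-tabulate⇒T {f = f} {i} i∈ = Equivalence.from T-≡ (trans (sym (lookup∘tabulate f i)) ([]=⇒lookup i∈))

∣p∪q∣≤∣p∣+∣q∣ : ∀ {n} (p q : Subset n) → ∣ p ∪ q ∣ ≤ ∣ p ∣ + ∣ q ∣
∣p∪q∣≤∣p∣+∣q∣ []            []            = z≤n
∣p∪q∣≤∣p∣+∣q∣ (inside  ∷ p) (inside  ∷ q) = s≤s (≤-trans (∣p∪q∣≤∣p∣+∣q∣ p q) (+-monoʳ-≤ ∣ p ∣ (n≤1+n ∣ q ∣)))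
∣p∪q∣≤∣p∣+∣q∣ (inside  ∷ p) (outside ∷ q) = s≤s (∣p∪q∣≤∣p∣+∣q∣ p q)
∣p∪q∣≤∣p∣+∣q∣ (outside ∷ p) (inside  ∷ q) = subst (suc ∣ p ∪ q ∣ ≤_) (sym (+-suc ∣ p ∣ ∣ q ∣)) (s≤s (∣p∪q∣≤∣p∣+∣q∣ p q))
∣p∪q∣≤∣p∣+∣q∣ (outside ∷ p) (outside ∷ q) = ∣p∪q∣≤∣p∣+∣q∣ p q

-- The binomial estimate behind e

private
  module B = Binomial +-*-semiring
  module S = Semiring +-*-semiring
  open RawMonoid S.+-rawMonoid using () renaming (_×_ to _×⁺_)
  open RawMonoid S.*-rawMonoid using () renaming (_×_ to _×*_)

×⁺≡* : ∀ m n → m ×⁺ n ≡ m * n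
×⁺≡* zero n = refl
×⁺≡* (suc m) n = cong (n +_) (×⁺≡* m n)

×*≡^ : ∀ m n → m ×* n ≡ n ^ m
×*≡^ zero n = refl
×*≡^ (suc m) n = cong (n *_) (×*≡^ m n)

binomialTerm[x,1]≡nCk*x^k : ∀ x n k → B.binomialTerm x 1 n k ≡ (n C toℕ k) * x ^ toℕ k
binomialTerm[x,1]≡nCk*x^k x n k = begin
  B.binomialTerm x 1 n k ≡⟨ ×⁺≡* (n C toℕ k) _ ⟩
  (n C toℕ k) * (toℕ k ×* x * (n ∸ toℕ k) ×* 1) ≡⟨ cong₂ (λ a b → (n C toℕ k) * (a * b)) (×*≡^ (toℕ k) x) (trans (×*≡^ (n ∸ toℕ k) 1) (^-zeroˡ (n ∸ toℕ k))) ⟩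
  (n C toℕ k) * (x ^ toℕ k * 1) ≡⟨ cong ((n C toℕ k) *_) (*-identityʳ _) ⟩
  (n C toℕ k) * x ^ toℕ k ∎
  where open ≡-Reasoning

binomial-theorem : ∀ x n → suc x ^ n ≡ ∑[ k ≤ n ] ((n C toℕ k) * x ^ toℕ k)
binomial-theorem x n = begin
  suc x ^ n ≡⟨ cong (_^ n) (+-comm x 1) ⟨
  (x + 1) ^ n ≡⟨ ×*≡^ n (x + 1) ⟨
  n ×* (x + 1) ≡⟨ B.theorem x 1 (*-comm x 1) n ⟩
  ∑[ k ≤ n ] B.binomialTerm x 1 n k ≡⟨ sum-cong-≗ (binomialTerm[x,1]≡nCk*x^k x n) ⟩
  ∑[ k ≤ n ] ((n C toℕ k) * x ^ toℕ k) ∎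
  where open ≡-Reasoning

[k+1]*[n+1]C[k+1]≡[n+1]*nCk : ∀ n k → suc k * (suc n C suc k) ≡ suc n * (n C k)
[k+1]*[n+1]C[k+1]≡[n+1]*nCk zero zero = refl
[k+1]*[n+1]C[k+1]≡[n+1]*nCk zero (suc k)
  rewrite k>n⇒nCk≡0 {1} {suc (suc k)} (s≤s (s≤s z≤n)) | k>n⇒nCk≡0 {0} {suc k} z<s = *-zeroʳ (suc (suc k))
[k+1]*[n+1]C[k+1]≡[n+1]*nCk (suc n) zero rewrite nC1≡n (suc (suc n)) = *-comm 1 (suc (suc n))
[k+1]*[n+1]C[k+1]≡[n+1]*nCk (suc n) (suc k) = begin
  suc (suc k) * (suc (suc n) C suc (suc k))
    ≡⟨ cong (suc (suc k) *_) (nCk+nC[k+1]≡[n+1]C[k+1] (suc n) (suc k)) ⟨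
  suc (suc k) * (c + c′)
    ≡⟨ pascal-split (suc k) c c′ ⟩
  suc k * c + c + suc (suc k) * c′
    ≡⟨ cong₂ (λ a b → a + c + b) ([k+1]*[n+1]C[k+1]≡[n+1]*nCk n k) ([k+1]*[n+1]C[k+1]≡[n+1]*nCk n (suc k)) ⟩
  suc n * (n C k) + c + suc n * (n C suc k)
    ≡⟨ cong (λ a → suc n * (n C k) + a + suc n * (n C suc k)) (nCk+nC[k+1]≡[n+1]C[k+1] n k) ⟨
  suc n * (n C k) + (n C k + n C suc k) + suc n * (n C suc k)
    ≡⟨ pascal-join (suc n) (n C k) (n C suc k) ⟩
  suc (suc n) * (n C k + n C suc k)
    ≡⟨ cong (suc (suc n) *_) (nCk+nC[k+1]≡[n+1]C[k+1] n k) ⟩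
  suc (suc n) * c ∎
  where
  open ≡-Reasoning
  c c′ : ℕ
  c = suc n C suc k
  c′ = suc n C suc (suc k)
  pascal-split : ∀ s a b → suc s * (a + b) ≡ s * a + a + suc s * b
  pascal-split = solve-∀
  pascal-join : ∀ s a b → s * a + (a + b) + s * b ≡ suc s * (a + b)
  pascal-join = solve-∀

eNum≡∑nCk*k! : ∀ n → eNum n ≡ ∑[ k ≤ n ] ((n C toℕ k) * toℕ k !)
eNum≡∑nCk*k! zero = refl
eNum≡∑nCk*k! (suc n) = begin
  suc n * eNum n + 1
    ≡⟨ cong (λ e → suc n * e + 1) (eNum≡∑nCk*k! n) ⟩
  suc n * ∑[ k ≤ n ] ((n C toℕ k) * toℕ k !) + 1
    ≡⟨ cong (_+ 1) (*-distribˡ-sum {suc n} (suc n) (λ k → (n C toℕ k) * toℕ k !)) ⟩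
  ∑[ k ≤ n ] (suc n * ((n C toℕ k) * toℕ k !)) + 1
    ≡⟨ cong (_+ 1) (sum-cong-≗ {suc n} (λ k → absorb (toℕ k))) ⟨
  ∑[ k ≤ n ] ((suc n C suc (toℕ k)) * suc (toℕ k) !) + 1
    ≡⟨ +-comm _ 1 ⟩
  ∑[ k ≤ suc n ] ((suc n C toℕ k) * toℕ k !) ∎
  where
  open ≡-Reasoning
  absorb : ∀ t → (suc n C suc t) * suc t ! ≡ suc n * ((n C t) * t !)
  absorb t = begin
    (suc n C suc t) * (suc t * t !) ≡⟨ x∙yz≈yx∙z (suc n C suc t) (suc t) (t !) ⟩
    suc t * (suc n C suc t) * t ! ≡⟨ cong (_* t !) ([k+1]*[n+1]C[k+1]≡[n+1]*nCk n t) ⟩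
    suc n * (n C t) * t ! ≡⟨ *-assoc (suc n) (n C t) (t !) ⟩
    suc n * ((n C t) * t !) ∎

x^t*j!≤t!*x^j : ∀ {x t j} → t ≤′ j → j ≤ x → x ^ t * j ! ≤ t ! * x ^ j
x^t*j!≤t!*x^j {x} {t} ≤′-refl _ = ≤-reflexive (*-comm (x ^ t) (t !))
x^t*j!≤t!*x^j {x} {t} (≤′-step {j} t≤′j) 1+j≤x = begin
  x ^ t * (suc j * j !) ≡⟨ x∙yz≈y∙xz (x ^ t) (suc j) (j !) ⟩
  suc j * (x ^ t * j !) ≤⟨ *-monoʳ-≤ (suc j) (x^t*j!≤t!*x^j t≤′j (≤-trans (n≤1+n j) 1+j≤x)) ⟩
  suc j * (t ! * x ^ j) ≤⟨ *-monoˡ-≤ (t ! * x ^ j) 1+j≤x ⟩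
  x * (t ! * x ^ j) ≡⟨ x∙yz≈y∙xz x (t !) (x ^ j) ⟩
  t ! * x ^ suc j ∎
  where open ≤-Reasoning

[1+x]^j*j!≤eNum[j]*x^j : ∀ {x j} → j ≤ x → suc x ^ j * j ! ≤ eNum j * x ^ j
[1+x]^j*j!≤eNum[j]*x^j {x} {j} j≤x = begin
  suc x ^ j * j !
    ≡⟨ cong (_* j !) (binomial-theorem x j) ⟩
  (∑[ k ≤ j ] ((j C toℕ k) * x ^ toℕ k)) * j !
    ≡⟨ *-distribʳ-sum {suc j} (j !) (λ k → (j C toℕ k) * x ^ toℕ k) ⟩
  ∑[ k ≤ j ] ((j C toℕ k) * x ^ toℕ k * j !)
    ≤⟨ sum-mono-≤ term ⟩
  ∑[ k ≤ j ] ((j C toℕ k) * toℕ k ! * x ^ j)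
    ≡⟨ *-distribʳ-sum {suc j} (x ^ j) (λ k → (j C toℕ k) * toℕ k !) ⟨
  (∑[ k ≤ j ] ((j C toℕ k) * toℕ k !)) * x ^ j
    ≡⟨ cong (_* x ^ j) (eNum≡∑nCk*k! j) ⟨
  eNum j * x ^ j ∎
  where
  open ≤-Reasoning
  term : ∀ k → (j C toℕ k) * x ^ toℕ k * j ! ≤ (j C toℕ k) * toℕ k ! * x ^ j
  term k = begin
    (j C toℕ k) * x ^ toℕ k * j ! ≡⟨ *-assoc (j C toℕ k) _ _ ⟩
    (j C toℕ k) * (x ^ toℕ k * j !) ≤⟨ *-monoʳ-≤ (j C toℕ k) (x^t*j!≤t!*x^j (≤⇒≤′ (toℕ≤pred[n] k)) j≤x) ⟩
    (j C toℕ k) * (toℕ k ! * x ^ j) ≡⟨ *-assoc (j C toℕ k) _ _ ⟨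
    (j C toℕ k) * toℕ k ! * x ^ j ∎

-- Weighted sums over subsets

-- wsum b n f = Σ_{W ⊆ [n]} b ^ (n − ∣ W ∣) * f W
wsum : ℕ → ∀ n → (Subset n → ℕ) → ℕ
wsum b zero f = f []
wsum b (suc n) f = b * wsum b n (f ∘ (outside ∷_)) + wsum b n (f ∘ (inside ∷_))

module _ (b : ℕ) where

  wsum-cong : ∀ n {f g : Subset n → ℕ} → (∀ W → f W ≡ g W) → wsum b n f ≡ wsum b n g
  wsum-cong zero f≗g = f≗g []
  wsum-cong (suc n) f≗g = cong₂ (λ x y → b * x + y) (wsum-cong n (f≗g ∘ (outside ∷_))) (wsum-cong n (f≗g ∘ (inside ∷_)))

  wsum-const : ∀ n c → wsum b n (λ _ → c) ≡ suc b ^ n * c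
  wsum-const zero c = sym (+-identityʳ c)
  wsum-const (suc n) c rewrite wsum-const n c = collect b (suc b ^ n) c
    where
    collect : ∀ b x c → b * (x * c) + x * c ≡ suc b * x * c
    collect = solve-∀

  wsum-+ : ∀ n (f g : Subset n → ℕ) → wsum b n (λ W → f W + g W) ≡ wsum b n f + wsum b n g
  wsum-+ zero f g = refl
  wsum-+ (suc n) f g
    rewrite wsum-+ n (f ∘ (outside ∷_)) (g ∘ (outside ∷_)) | wsum-+ n (f ∘ (inside ∷_)) (g ∘ (inside ∷_)) = interchange b _ _ _ _
    where
    interchange : ∀ b x y z w → b * (x + y) + (z + w) ≡ b * x + z + (b * y + w)
    interchange = solve-∀

  wsum-*ˡ : ∀ n c (f : Subset n → ℕ) → wsum b n (λ W → c * f W) ≡ c * wsum b n f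
  wsum-*ˡ zero c f = refl
  wsum-*ˡ (suc n) c f
    rewrite wsum-*ˡ n c (f ∘ (outside ∷_)) | wsum-*ˡ n c (f ∘ (inside ∷_)) = pull c b _ _
    where
    pull : ∀ c b x y → b * (c * x) + c * y ≡ c * (b * x + y)
    pull = solve-∀

  wsum-∑ : ∀ n {p} (f : Fin p → Subset n → ℕ) → wsum b n (λ W → ∑[ i < p ] f i W) ≡ ∑[ i < p ] wsum b n (f i)
  wsum-∑ n {zero} f = trans (wsum-const n 0) (*-zeroʳ (suc b ^ n))
  wsum-∑ n {suc p} f = trans (wsum-+ n (f zero) _) (cong (wsum b n (f zero) +_) (wsum-∑ n (f ∘ suc)))

  wsum-∣∣ : ∀ n → suc b * wsum b n ∣_∣ ≡ n * suc b ^ n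
  wsum-∣∣ zero = *-zeroʳ (suc b)
  wsum-∣∣ (suc n) = begin
    suc b * (b * S + wsum b n (λ W → 1 + ∣ W ∣))
      ≡⟨ cong (λ x → suc b * (b * S + x)) (trans (wsum-+ n (λ _ → 1) ∣_∣) (cong (_+ S) (wsum-const n 1))) ⟩
    suc b * (b * S + (K * 1 + S))
      ≡⟨ expand b S K ⟩
    suc b * K + suc b * (suc b * S)
      ≡⟨ cong (λ x → suc b * K + suc b * x) (wsum-∣∣ n) ⟩
    suc b * K + suc b * (n * K)
      ≡⟨ collect b n K ⟩
    suc n * (suc b * K) ∎
    where
    open ≡-Reasoning
    S K : ℕ
    S = wsum b n ∣_∣
    K = suc b ^ n
    expand : ∀ b S K → suc b * (b * S + (K * 1 + S)) ≡ suc b * K + suc b * (suc b * S)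
    expand = solve-∀
    collect : ∀ b n K → suc b * K + suc b * (n * K) ≡ suc n * (suc b * K)
    collect = solve-∀

  private
    other-half-< : ∀ {x₀ x₁ y₀ y₁} → b * x₀ + x₁ ≤ b * y₀ + y₁ → y₁ < x₁ → x₀ < y₀
    other-half-< {x₀} {x₁} {y₀} {y₁} le y₁<x₁ with x₀ <? y₀
    ... | yes x₀<y₀ = x₀<y₀
    ... | no x₀≮y₀ = contradiction le (<⇒≱ (+-mono-≤-< (*-monoʳ-≤ b (≮⇒≥ x₀≮y₀)) y₁<x₁))

  ∃-≤ : ∀ n (f g : Subset n → ℕ) → wsum b n f ≤ wsum b n g → ∃[ W ] f W ≤ g W
  ∃-≤ zero f g f≤g = [] , f≤g
  ∃-≤ (suc n) f g f≤g with wsum b n (f ∘ (inside ∷_)) ≤? wsum b n (g ∘ (inside ∷_))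
  ... | yes f₁≤g₁ = map (inside ∷_) id (∃-≤ n _ _ f₁≤g₁)
  ... | no f₁≰g₁ = map (outside ∷_) id (∃-≤ n _ _ (<⇒≤ (other-half-< f≤g (≰⇒> f₁≰g₁))))

  ∃-nonempty-≤ : ∀ n (f g : Subset (suc n) → ℕ) → g ⊥ ≡ 0 →
    wsum b (suc n) f ≤ wsum b (suc n) g → ∃[ W ] 0 < ∣ W ∣ × f W ≤ g W
  ∃-nonempty-≤-outside : ∀ n (f g : Subset (suc n) → ℕ) → g ⊥ ≡ 0 →
    wsum b n (f ∘ (outside ∷_)) < wsum b n (g ∘ (outside ∷_)) → ∃[ W ] 0 < ∣ W ∣ × f W ≤ g W

  ∃-nonempty-≤ n f g g⊥≡0 f≤g with wsum b n (f ∘ (inside ∷_)) ≤? wsum b n (g ∘ (inside ∷_))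
  ... | yes f₁≤g₁ = let W , f≤g = ∃-≤ n _ _ f₁≤g₁ in inside ∷ W , z<s , f≤g
  ... | no f₁≰g₁ = ∃-nonempty-≤-outside n f g g⊥≡0 (other-half-< f≤g (≰⇒> f₁≰g₁))

  ∃-nonempty-≤-outside zero f g g⊥≡0 f₀<g₀ = contradiction (subst (_ <_) g⊥≡0 f₀<g₀) n≮0
  ∃-nonempty-≤-outside (suc n) f g g⊥≡0 f₀<g₀ = map (outside ∷_) id (∃-nonempty-≤ n _ _ g⊥≡0 (<⇒≤ f₀<g₀))

private
  admits : Side → Side → Side → Bool
  admits w inside  _       = w
  admits w outside inside  = not w
  admits _ outside outside = true

-- isolates W R C holds iff R ⊆ W and W ∩ C ⊆ R.
isolates : ∀ {n} → Subset n → Subset n → Subset n → Bool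
isolates []      []      []      = true
isolates (w ∷ W) (r ∷ R) (c ∷ C) = admits w r c ∧ isolates W R C

isolates⇒⊆ : ∀ {n} {W R C : Subset n} → T (isolates W R C) → R ⊆ W
isolates⇒⊆ {W = inside ∷ _}  {inside ∷ _} {_ ∷ _} _  here = here
isolates⇒⊆ {W = outside ∷ _} {inside ∷ _} {_ ∷ _} () here
isolates⇒⊆ {W = _ ∷ _} {_ ∷ _} {_ ∷ _} t (there x∈R) = there (isolates⇒⊆ (proj₂ (Equivalence.to T-∧ t)) x∈R)

isolates⇒∩⊆ : ∀ {n} {W R C : Subset n} {x} → T (isolates W R C) → x ∈ W → x ∈ C → x ∈ R
isolates⇒∩⊆ {R = inside ∷ _}  _  here here = here
isolates⇒∩⊆ {R = outside ∷ _} () here here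
isolates⇒∩⊆ {W = _ ∷ _} {_ ∷ _} {_ ∷ _} t (there x∈W) (there x∈C) =
  there (isolates⇒∩⊆ (proj₂ (Equivalence.to T-∧ t)) x∈W x∈C)

-- Coordinatewise, the admissible values carry total weight 1 on R, b on C ∖ R and 1 + b elsewhere.
wsum-isolates : ∀ b {n} (R C : Subset n) →
  wsum b n (λ W → 𝟙 (isolates W R C)) * suc b ^ ∣ R ∪ C ∣ * b ^ ∣ R ∣ ≡ suc b ^ n * b ^ ∣ R ∪ C ∣
wsum-isolates b [] [] = refl
wsum-isolates b {suc n} (r ∷ R) (c ∷ C) = coordinate r c
  where
  open ≡-Reasoning
  S K KA BR BA : ℕ
  S  = wsum b n (λ W → 𝟙 (isolates W R C))
  K  = suc b ^ n
  KA = suc b ^ ∣ R ∪ C ∣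
  BR = b ^ ∣ R ∣
  BA = b ^ ∣ R ∪ C ∣

  wsum-0 : wsum b n (λ _ → 0) ≡ 0
  wsum-0 = trans (wsum-const b n 0) (*-zeroʳ K)

  constrained : suc b * b * (S * KA * BR) ≡ suc b * K * (b * BA)
  constrained = trans (cong (suc b * b *_) (wsum-isolates b R C)) (regroup b K BA)
    where
    regroup : ∀ b K BA → suc b * b * (K * BA) ≡ suc b * K * (b * BA)
    regroup = solve-∀

  coordinate : ∀ r c →
    wsum b (suc n) (λ W → 𝟙 (isolates W (r ∷ R) (c ∷ C))) * suc b ^ ∣ (r ∷ R) ∪ (c ∷ C) ∣ * b ^ ∣ r ∷ R ∣
      ≡ suc b * K * b ^ ∣ (r ∷ R) ∪ (c ∷ C) ∣
  coordinate inside c = begin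
    (b * wsum b n (λ _ → 0) + S) * (suc b * KA) * (b * BR) ≡⟨ cong (λ z → (b * z + S) * (suc b * KA) * (b * BR)) wsum-0 ⟩
    (b * 0 + S) * (suc b * KA) * (b * BR)                 ≡⟨ regroup b S KA BR ⟩
    suc b * b * (S * KA * BR)                             ≡⟨ constrained ⟩
    suc b * K * (b * BA)                                  ∎
    where
    regroup : ∀ b S KA BR → (b * 0 + S) * (suc b * KA) * (b * BR) ≡ suc b * b * (S * KA * BR)
    regroup = solve-∀
  coordinate outside inside = begin
    (b * S + wsum b n (λ _ → 0)) * (suc b * KA) * BR ≡⟨ cong (λ z → (b * S + z) * (suc b * KA) * BR) wsum-0 ⟩
    (b * S + 0) * (suc b * KA) * BR                 ≡⟨ regroup b S KA BR ⟩
    suc b * b * (S * KA * BR)                       ≡⟨ constrained ⟩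
    suc b * K * (b * BA)                            ∎
    where
    regroup : ∀ b S KA BR → (b * S + 0) * (suc b * KA) * BR ≡ suc b * b * (S * KA * BR)
    regroup = solve-∀
  coordinate outside outside = begin
    (b * S + S) * KA * BR  ≡⟨ regroup b S KA BR ⟩
    suc b * (S * KA * BR)  ≡⟨ cong (suc b *_) (wsum-isolates b R C) ⟩
    suc b * (K * BA)       ≡⟨ *-assoc (suc b) K BA ⟨
    suc b * K * BA         ∎
    where
    regroup : ∀ b S KA BR → (b * S + S) * KA * BR ≡ suc b * (S * KA * BR)
    regroup = solve-∀

isolation-bound : ∀ j {n A B P} → A ≤ 2 + j → B ≤ 2 →
  P * (2 + j) ^ A * suc j ^ B ≡ (2 + j) ^ n * suc j ^ A →
  (2 + j) ^ n * suc j ^ j ≤ P * (2 + j) ^ (2 + j)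
isolation-bound j {n} {A} {B} {P} A≤k B≤2 eq with m≤n⇒∃[o]m+o≡n A≤k
... | r , A+r≡k = *-cancelʳ-≤ _ _ (b ^ 2) (begin
  k ^ n * b ^ j * b ^ 2        ≡⟨ *-assoc (k ^ n) (b ^ j) (b ^ 2) ⟩
  k ^ n * (b ^ j * b ^ 2)      ≡⟨ cong (k ^ n *_) (^-distribˡ-+-* b j 2) ⟨
  k ^ n * b ^ (j + 2)          ≡⟨ cong (λ e → k ^ n * b ^ e) (trans (+-comm j 2) (sym A+r≡k)) ⟩
  k ^ n * b ^ (A + r)          ≡⟨ cong (k ^ n *_) (^-distribˡ-+-* b A r) ⟩
  k ^ n * (b ^ A * b ^ r)      ≡⟨ *-assoc (k ^ n) (b ^ A) (b ^ r) ⟨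
  k ^ n * b ^ A * b ^ r        ≡⟨ cong (_* b ^ r) eq ⟨
  P * k ^ A * b ^ B * b ^ r    ≤⟨ *-mono-≤ (*-monoʳ-≤ (P * k ^ A) (^-monoʳ-≤ b B≤2)) (^-monoˡ-≤ r (n≤1+n b)) ⟩
  P * k ^ A * b ^ 2 * k ^ r    ≡⟨ rearrange P (k ^ A) (b ^ 2) (k ^ r) ⟩
  P * (k ^ A * k ^ r) * b ^ 2  ≡⟨ cong (λ x → P * x * b ^ 2) (trans (sym (^-distribˡ-+-* k A r)) (cong (k ^_) A+r≡k)) ⟩
  P * k ^ k * b ^ 2            ∎)
  where
  open ≤-Reasoning
  k b : ℕ
  k = 2 + j
  b = suc j
  rearrange : ∀ P x y z → P * x * y * z ≡ P * (x * z) * y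
  rearrange = solve-∀

a*x^j≤c*[1+x]^j⇒LeTimesE : ∀ {a c x j} .{{_ : NonZero x}} → j ≤ x → a * x ^ j ≤ c * suc x ^ j → LeTimesE a c
a*x^j≤c*[1+x]^j⇒LeTimesE {a} {c} {x} {j} j≤x a*x^j≤c*[1+x]^j =
  j , *-cancelʳ-≤ (a * j !) (c * eNum j) (x ^ j) {{m^n≢0 x j}} (begin
    a * j ! * x ^ j        ≡⟨ *-assoc a (j !) (x ^ j) ⟩
    a * (j ! * x ^ j)      ≡⟨ cong (a *_) (*-comm (j !) (x ^ j)) ⟩
    a * (x ^ j * j !)      ≡⟨ *-assoc a (x ^ j) (j !) ⟨
    a * x ^ j * j !        ≤⟨ *-monoˡ-≤ (j !) a*x^j≤c*[1+x]^j ⟩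
    c * suc x ^ j * j !    ≡⟨ *-assoc c (suc x ^ j) (j !) ⟩
    c * (suc x ^ j * j !)  ≤⟨ *-monoʳ-≤ c ([1+x]^j*j!≤eNum[j]*x^j j≤x) ⟩
    c * (eNum j * x ^ j)   ≡⟨ *-assoc c (eNum j) (x ^ j) ⟨
    c * eNum j * x ^ j     ∎)
  where open ≤-Reasoning

-- Pairs isolated by a random subset

module IsolatedPairs {n j p} (e : Fin p → Subset (suc n)) (u v : Fin p → Fin (suc n))
  (∣e∣≤k : ∀ i → ∣ e i ∣ ≤ 2 + j) (uv∈e : ∀ i → u i ∈ e i × v i ∈ e i) where

  -- b = k − 1 is the weight of a vertex outside W, as in wsum.
  private
    N b k : ℕ
    N = suc n
    b = suc j
    k = 2 + j

  ends : Fin p → Subset N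
  ends i = ⁅ u i ⁆ ∪ ⁅ v i ⁆

  survivors : Subset N → Subset p
  survivors W = tabulate (λ i → isolates W (ends i) (e i))

  survival-weight : Fin p → ℕ
  survival-weight i = wsum b N (λ W → 𝟙 (isolates W (ends i) (e i)))

  u∈ends : ∀ i → u i ∈ ends i
  u∈ends i = x∈p∪q⁺ (inj₁ (x∈⁅x⁆ (u i)))

  v∈ends : ∀ i → v i ∈ ends i
  v∈ends i = x∈p∪q⁺ (inj₂ (x∈⁅x⁆ (v i)))

  ∈ends⇒≡ : ∀ {i w} → w ∈ ends i → w ≡ u i ⊎ w ≡ v i
  ∈ends⇒≡ {i} w∈ with x∈p∪q⁻ ⁅ u i ⁆ ⁅ v i ⁆ w∈
  ... | inj₁ w∈u = inj₁ (x∈⁅y⁆⇒x≡y (u i) w∈u)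
  ... | inj₂ w∈v = inj₂ (x∈⁅y⁆⇒x≡y (v i) w∈v)

  ends∪e⊆e : ∀ i → ends i ∪ e i ⊆ e i
  ends∪e⊆e i w∈ with x∈p∪q⁻ (ends i) (e i) w∈
  ... | inj₂ w∈e = w∈e
  ... | inj₁ w∈ends with ∈ends⇒≡ w∈ends
  ...   | inj₁ refl = proj₁ (uv∈e i)
  ...   | inj₂ refl = proj₂ (uv∈e i)

  ∣ends∣≤2 : ∀ i → ∣ ends i ∣ ≤ 2
  ∣ends∣≤2 i = subst₂ (λ x y → ∣ ends i ∣ ≤ x + y) (∣⁅x⁆∣≡1 (u i)) (∣⁅x⁆∣≡1 (v i)) (∣p∪q∣≤∣p∣+∣q∣ ⁅ u i ⁆ ⁅ v i ⁆)

  survivor-ends : ∀ {W i} → i ∈ survivors W → u i ∈ W × v i ∈ W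
  survivor-ends i∈F = ends⊆W (u∈ends _) , ends⊆W (v∈ends _)
    where ends⊆W = isolates⇒⊆ (∈-tabulate⇒T i∈F)

  survivor-isolated : ∀ {W i w} → i ∈ survivors W → w ∈ W → w ∈ e i → w ≡ u i ⊎ w ≡ v i
  survivor-isolated i∈F w∈W w∈e = ∈ends⇒≡ (isolates⇒∩⊆ (∈-tabulate⇒T i∈F) w∈W w∈e)

  no-survivors-in-⊥ : ∣ survivors ⊥ ∣ ≡ 0
  no-survivors-in-⊥ = begin
    ∣ survivors ⊥ ∣                            ≡⟨ ∣tabulate∣≡∑𝟙 (λ i → isolates ⊥ (ends i) (e i)) ⟩
    ∑[ i < p ] 𝟙 (isolates ⊥ (ends i) (e i))   ≡⟨ sum-cong-≗ {p} not-isolated ⟩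
    ∑[ i < p ] 0                               ≡⟨ sum-const p 0 ⟩
    p * 0                                      ≡⟨ *-zeroʳ p ⟩
    0                                          ∎
    where
    open ≡-Reasoning
    not-isolated : ∀ i → 𝟙 (isolates ⊥ (ends i) (e i)) ≡ 0
    not-isolated i with isolates ⊥ (ends i) (e i) in eq
    ... | false = refl
    ... | true  = contradiction (isolates⇒⊆ (Equivalence.from T-≡ eq) (u∈ends i)) ∉⊥

  survival-weight-bound : ∀ i → k ^ N * b ^ j ≤ survival-weight i * k ^ k
  survival-weight-bound i = isolation-bound j {N} {P = survival-weight i}
    (≤-trans (p⊆q⇒∣p∣≤∣q∣ {p = ends i ∪ e i} (ends∪e⊆e i)) (∣e∣≤k i))
    (∣ends∣≤2 i)
    (wsum-isolates b (ends i) (e i))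

  wsum-survivors : wsum b N (λ W → ∣ survivors W ∣) ≡ ∑[ i < p ] survival-weight i
  wsum-survivors = trans (wsum-cong b N (λ W → ∣tabulate∣≡∑𝟙 (λ i → isolates W (ends i) (e i))))
                         (wsum-∑ b N (λ i W → 𝟙 (isolates W (ends i) (e i))))

  wsum-size≤wsum-survivors : wsum b N (λ W → p * b ^ j * ∣ W ∣) ≤ wsum b N (λ W → N * k ^ suc j * ∣ survivors W ∣)
  wsum-size≤wsum-survivors = *-cancelˡ-≤ k (begin
    k * wsum b N (λ W → p * b ^ j * ∣ W ∣)    ≡⟨ cong (k *_) (wsum-*ˡ b N (p * b ^ j) ∣_∣) ⟩
    k * (p * b ^ j * wsum b N ∣_∣)            ≡⟨ x∙yz≈y∙xz k (p * b ^ j) _ ⟩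
    p * b ^ j * (k * wsum b N ∣_∣)            ≡⟨ cong (p * b ^ j *_) (wsum-∣∣ b N) ⟩
    p * b ^ j * (N * k ^ N)                   ≡⟨ regroup p (b ^ j) N (k ^ N) ⟩
    N * (p * (k ^ N * b ^ j))                 ≡⟨ cong (N *_) (sum-const p _) ⟨
    N * ∑[ i < p ] (k ^ N * b ^ j)            ≤⟨ *-monoʳ-≤ N (sum-mono-≤ survival-weight-bound) ⟩
    N * ∑[ i < p ] (survival-weight i * k ^ k) ≡⟨ cong (N *_) (*-distribʳ-sum {p} (k ^ k) survival-weight) ⟨
    N * (∑[ i < p ] survival-weight i * k ^ k) ≡⟨ regroup′ N _ k (k ^ suc j) ⟩
    k * (N * k ^ suc j * ∑[ i < p ] survival-weight i) ≡⟨ cong (λ s → k * (N * k ^ suc j * s)) wsum-survivors ⟨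
    k * (N * k ^ suc j * wsum b N (λ W → ∣ survivors W ∣)) ≡⟨ cong (k *_) (wsum-*ˡ b N (N * k ^ suc j) (λ W → ∣ survivors W ∣)) ⟨
    k * wsum b N (λ W → N * k ^ suc j * ∣ survivors W ∣) ∎)
    where
    open ≤-Reasoning
    regroup : ∀ p B N K → p * B * (N * K) ≡ N * (p * (K * B))
    regroup = solve-∀
    regroup′ : ∀ N S k K → N * (S * (k * K)) ≡ k * (N * K * S)
    regroup′ = solve-∀

  isolated-subgraph : Σ (Subset N) λ W → Σ (Subset p) λ F →
    (0 < ∣ W ∣) ×
    (∀ i → i ∈ F → (u i ∈ W) × (v i ∈ W)) ×
    (∀ i → i ∈ F → ∀ w → w ∈ W → w ∈ e i → (w ≡ u i) ⊎ (w ≡ v i)) ×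
    LeTimesE (p * ∣ W ∣) (∣ F ∣ * N * k)
  isolated-subgraph
    with ∃-nonempty-≤ b n (λ W → p * b ^ j * ∣ W ∣) (λ W → N * k ^ suc j * ∣ survivors W ∣)
           (trans (cong (N * k ^ suc j *_) no-survivors-in-⊥) (*-zeroʳ (N * k ^ suc j))) wsum-size≤wsum-survivors
  ... | W , 0<∣W∣ , W-good =
    W , survivors W , 0<∣W∣ , (λ _ → survivor-ends) , (λ _ i∈F _ → survivor-isolated i∈F) ,
    a*x^j≤c*[1+x]^j⇒LeTimesE {p * ∣ W ∣} {∣ survivors W ∣ * N * k} (n≤1+n j)
      (subst₂ _≤_ (regroup p (b ^ j) ∣ W ∣) (regroup′ N (k ^ j) k ∣ survivors W ∣) W-good)
    where
    regroup : ∀ p B w → p * B * w ≡ p * w * B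
    regroup = solve-∀
    regroup′ : ∀ N K k f → N * (k * K) * f ≡ f * N * k * K
    regroup′ = solve-∀

lemma3p1 : (n k m p : ℕ) → 2 ≤ k → 1 ≤ n →
    (ℰ : Vec (Subset n) m) → (∀ j → ∣ lookup ℰ j ∣ ≤ k) →
    (E : Vec (Fin n × Fin n) p) →
    (∀ i → fstP E i <ᶠ sndP E i) →
    (∀ i j → lookup E i ≡ lookup E j → i ≡ j) →
    (c : Fin p → Fin m) →
    (∀ i → (fstP E i ∈ lookup ℰ (c i)) × (sndP E i ∈ lookup ℰ (c i))) →
    Σ (Subset n) λ W → Σ (Subset p) λ F →
      (0 < ∣ W ∣) ×
      (∀ i → i ∈ F → (fstP E i ∈ W) × (sndP E i ∈ W)) ×
      (∀ i → i ∈ F → ∀ w → w ∈ W → w ∈ lookup ℰ (c i) →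
        (w ≡ fstP E i) ⊎ (w ≡ sndP E i)) ×
      LeTimesE (p * ∣ W ∣) (∣ F ∣ * n * k)
lemma3p1 (suc n) (suc (suc j)) m p (s≤s (s≤s z≤n)) (s≤s z≤n) ℰ ∣ℰ∣≤k E _ _ c uv∈e =
  IsolatedPairs.isolated-subgraph (lookup ℰ ∘ c) (fstP E) (sndP E) (∣ℰ∣≤k ∘ c) uv∈e
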